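{- Let $\alpha$ be a square-free positive rational number, let $\mathcal T$ be a primitive factorization tree for $\alpha$, and let $\mathcal G=(G,\mu)$ be a measure class graph for $\mathcal T$. Then the digraph $G$ is a binary tree, i.e., a rooted tree (with edges directed from each vertex to its children) in which every vertex has at most two children.
   Context: Write $\alpha=a/b$ with $a,b$ coprime positive integers; $\alpha$ is square-free if $a$ and $b$ are both square-free. Let $p_1\ge\cdots\ge p_N$ be the primes dividing $ab$, listed with multiplicity. Put $\gamma(i)=1$ if $p_i\mid a$, $\gamma(i)=-1$ if $p_i\mid b$, and $\alpha_n=\prod_{i=1}^n p_i^{\gamma(i)}$ for $0\le n\le N$. A factorization of a positive rational $\beta$ is a sequence $(a_1/b_1,a_2/b_2,\dots)$ with $a_i,b_i$ positive integers, $a_i=b_i=1$ for all but finitely many $i$, $\prod_i a_i/b_i=\beta$, $\max\{a_i,b_i\}\ge\max\{a_{i+1},b_{i+1}\}$ for all $i$, and $\gcd(a_i,b_j)=1$ for all $i,j$; it is primitive if each $\max\{a_i,b_i\}$ is prime or $1$. Let $\mathfrak F_\alpha$ ($\mathfrak P_\alpha$) be the set of all (primitive) factorizations of $\alpha_n$, $0\le n\le N$. For $0\le n<N$, a factorization $(a_i/b_i)$ of $\alpha_n$ is a direct subfactorization of a factorization $(c_i/d_i)$ of $\alpha_{n+1}$ if either $p_{n+1}\mid a$ and for some $k$: $d_i=b_i$ for all $i$, $c_i=a_i$ for $i\ne k$, $c_k=a_kp_{n+1}$; or $p_{n+1}\mid b$ and for some $k$: $c_i=a_i$ for all $i$, $d_i=b_i$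 for $i\ne k$, $d_k=b_kp_{n+1}$. A factorization tree for $\alpha$ is a pair $(T,\nu)$ with $T$ a rooted tree (digraph with edges from each vertex to its children) and $\nu:V(T)\to\mathfrak F_\alpha$, with parenting map $\phi$, such that: (1) root $r_0$ has $\nu(r_0)=(1,1,\dots)$; (2) if $n<N$ and $\nu(r)$ is a factorization of $\alpha_n$ then $r$ has a child; (3) $\nu(r)=\nu(s)$ and $\phi(r)=\phi(s)$ imply $r=s$; (4) for non-root $r$, $\nu(\phi(r))$ is a direct subfactorization of $\nu(r)$. It is primitive if $\nu(V(T))\subseteq\mathfrak P_\alpha$. For $\mathbf A=(a_1/b_1,a_2/b_2,\dots)$ let $m(\mathbf A)=(\log\max\{a_1,b_1\},\log\max\{a_2,b_2\},\dots)$. Elements $\mathbf A,\mathbf B\in\mathfrak F_\alpha$ are measure equivalent, $\mathbf A\sim\mathbf B$, if they are factorizations of the same rational number and $m(\mathbf A)=m(\mathbf B)$; $\overline{\mathfrak F}_\alpha$ is the set of classes $[\mathbf A]$ and $f(\mathbf A)=[\mathbf A]$. A measure class graph for a factorization tree $\mathcal T=(T,\nu)$ is a pair $(G,\mu)$ with $G$ a digraph and $\mu:V(G)\to\overline{\mathfrak F}_\alpha$ injective, such that there exists a surjective map $\pi:V(T)\to V(G)$ with: $(\pi(r),\pi(s))\in E(G)$ whenever $(r,s)\in E(T)$; $\mu(\pi(r))=f(\nu(r))$ for all $r$; and for all $g,h\in\pi(V(T))$ with $(g,h)\in E(G)$ there is $(r,s)\in E(T)$ with $(\pi(r),\pi(s))=(g,h)$.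 -}

module Defs where

open import Data.Nat using (ℕ; zero; suc; _*_; _≤_; _<_; _≥_; _⊔_)
open import Data.Nat.Divisibility using (_∣_; _∣?_)
open import Data.Nat.Primality using (Prime)
open import Data.Nat.Coprimality using (Coprime)
open import Data.List using (List; []; _∷_; take; filter; length)
open import Data.Nat.ListAction using (product)
open import Data.List.Relation.Unary.All using (All)
open import Data.List.Relation.Unary.Linked using (Linked)
open import Data.Product using (Σ; ∃; ∃-syntax; _×_; _,_; proj₁; proj₂)
open import Data.Sum using (_⊎_)
open import Relation.Binary.PropositionalEquality using (_≡_; _≢_)
open import Relation.Binary.Construct.Closure.ReflexiveTransitive using (Star)
open import Relation.Nullary using (¬_)

SquareFree : ℕ → Set
SquareFree n = ∀ p → Prime p → ¬ (p * p ∣ n)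

SquareFreeRational : ℕ → ℕ → Set
SquareFreeRational a b = 0 < a × 0 < b × Coprime a b × SquareFree a × SquareFree b

-- ps = (p_1 ≥ p_2 ≥ ... ≥ p_N): the primes dividing ab, with multiplicity
-- (by unique factorisation this determines ps from a and b)
PrimeList : ℕ → ℕ → List ℕ → Set
PrimeList a b ps = All Prime ps × Linked _≥_ ps × product ps ≡ a * b

-- pAt ps n = p_{n+1}
pAt : List ℕ → ℕ → ℕ
pAt []       _       = 1
pAt (p ∷ _)  zero    = p
pAt (_ ∷ ps) (suc n) = pAt ps n

-- α_n = numα a ps n / denα b ps n  (in lowest terms)
numα : ℕ → List ℕ → ℕ → ℕ
numα a ps n = product (filter (λ p → p ∣? a) (take n ps))

denα : ℕ → List ℕ → ℕ → ℕ
denα b ps n = product (filter (λ p → p ∣? b) (take n ps))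

-- Sequences of fractions (a_i / b_i), i = 0,1,2,...  (index 0 = paper's index 1)

Seq : Set
Seq = ℕ → ℕ × ℕ

mx : Seq → ℕ → ℕ
mx s i = proj₁ (s i) ⊔ proj₂ (s i)

prodNum : ℕ → Seq → ℕ
prodNum zero    s = 1
prodNum (suc M) s = prodNum M s * proj₁ (s M)

prodDen : ℕ → Seq → ℕ
prodDen zero    s = 1
prodDen (suc M) s = prodDen M s * proj₂ (s M)

Supported : ℕ → Seq → Set
Supported M s = ∀ i → M ≤ i → s i ≡ (1 , 1)

_≐_ : Seq → Seq → Set
s ≐ t = ∀ i → s i ≡ t i

trivial : Seq
trivial _ = (1 , 1)

IsFactorizationOf : ℕ → ℕ → Seq → Set
IsFactorizationOf A B s =
  (∀ i → 0 < proj₁ (s i) × 0 < proj₂ (s i)) ×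
  (∃[ M ] (Supported M s × A * prodDen M s ≡ B * prodNum M s)) ×
  (∀ i → mx s (suc i) ≤ mx s i) ×
  (∀ i j → Coprime (proj₁ (s i)) (proj₂ (s j)))

IsPrimitive : Seq → Set
IsPrimitive s = ∀ i → Prime (mx s i) ⊎ mx s i ≡ 1

FactAt : ℕ → ℕ → List ℕ → ℕ → Seq → Set
FactAt a b ps n s = IsFactorizationOf (numα a ps n) (denα b ps n) s

InF : ℕ → ℕ → List ℕ → Seq → Set
InF a b ps s = ∃[ n ] (n ≤ length ps × FactAt a b ps n s)

DirectSub : ℕ → ℕ → List ℕ → Seq → Seq → Set
DirectSub a b ps s t =
  ∃[ n ] (suc n ≤ length ps × FactAt a b ps n s × FactAt a b ps (suc n) t ×
    ((pAt ps n ∣ a × ∃[ k ] ((∀ i → proj₂ (t i) ≡ proj₂ (s i)) ×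
                             (∀ i → i ≢ k → proj₁ (t i) ≡ proj₁ (s i)) ×
                             proj₁ (t k) ≡ proj₁ (s k) * pAt ps n))
     ⊎
     (pAt ps n ∣ b × ∃[ k ] ((∀ i → proj₁ (t i) ≡ proj₁ (s i)) ×
                             (∀ i → i ≢ k → proj₂ (t i) ≡ proj₂ (s i)) ×
                             proj₂ (t k) ≡ proj₂ (s k) * pAt ps n))))

-- measure equivalence (log is injective on positive integers, so equality of
-- m(A), m(B) is equality of the maxima)
SameValue : Seq → Seq → Set
SameValue s t = ∃[ M ] (Supported M s × Supported M t ×
                        prodNum M s * prodDen M t ≡ prodNum M t * prodDen M s)

MeasEq : Seq → Seq → Set
MeasEq s t = SameValue s t × (∀ i → mx s i ≡ mx t i)

record Digraph : Set₁ where
  field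
    V : Set
    E : V → V → Set
open Digraph public

IsRootedTree : (G : Digraph) → V G → Set
IsRootedTree G r =
  (∀ u → ¬ E G u r) ×
  (∀ v → v ≢ r → ∃[ u ] (E G u v × (∀ w → E G w v → w ≡ u))) ×
  (∀ v → Star (E G) r v)

IsBinaryTree : Digraph → Set
IsBinaryTree G =
  ∃[ r ] (IsRootedTree G r ×
    (∀ v x y z → E G v x → E G v y → E G v z → x ≡ y ⊎ x ≡ z ⊎ y ≡ z))

IsFactorizationTree : ℕ → ℕ → List ℕ → (T : Digraph) → V T → (V T → Seq) → Set
IsFactorizationTree a b ps T r₀ ν =
  IsRootedTree T r₀ ×
  (∀ r → InF a b ps (ν r)) ×
  (ν r₀ ≐ trivial) ×
  (∀ r n → suc n ≤ length ps → FactAt a b ps n (ν r) → ∃[ c ] E T r c) ×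
  (∀ u r s → E T u r → E T u s → ν r ≐ ν s → r ≡ s) ×
  (∀ u r → E T u r → DirectSub a b ps (ν u) (ν r))

IsPrimitiveFactorizationTree : ℕ → ℕ → List ℕ → (T : Digraph) → V T → (V T → Seq) → Set
IsPrimitiveFactorizationTree a b ps T r₀ ν =
  IsFactorizationTree a b ps T r₀ ν × (∀ r → IsPrimitive (ν r))

-- μ : V(G) → 𝔉̄_α is given by representatives; injectivity and equalities
-- in 𝔉̄_α are taken up to measure equivalence.
IsMeasureClassGraph : ℕ → ℕ → List ℕ → (T : Digraph) → (V T → Seq) →
                      (G : Digraph) → (V G → Seq) → Set
IsMeasureClassGraph a b ps T ν G μ =
  (∀ g → InF a b ps (μ g)) ×
  (∀ g h → MeasEq (μ g) (μ h) → g ≡ h) ×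
  Σ (V T → V G) λ π → ((∀ g → ∃[ r ] π r ≡ g) ×
          (∀ r s → E T r s → E G (π r) (π s)) ×
          (∀ r → MeasEq (μ (π r)) (ν r)) ×
          (∀ g h → E G g h → ∃[ r ] ∃[ s ] (E T r s × π r ≡ g × π s ≡ h)))

-- Let p_1 > … > p_N be the primes
-- of ab (distinct, as ab is square-free) and α_n = numα a ps n / denα b ps n.
--  1. Levels: α_n ≠ α_m for n ≠ m, since p_{n+1} divides α_m (m > n) but
--     not α_n; so a factorization's value determines its level.
--  2. Edges: if u ↦ v is a direct subfactorization at level n, v primitive,
--     every entry of u is 1 or exceeds p = p_{n+1}, so the profile mx v is
--     mx u or mx u with one entry 1 replaced by p (a MaxStep).  Erasing p
--     recovers mx u, and as profiles are non-increasing, a profile has at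
--     most two successors.
--  3. Graph: G is the image of the tree T; by 2, parents in G are unique and
--     there are at most two children; the root (1,1,…) has no parent.

module Submission where

open import Defs
open import Data.Nat
  using (ℕ; zero; suc; _*_; _⊔_; _≤_; _<_; _>_; _≥_; z≤n; s≤s; z<s; _≟_; _<?_;
         NonZero; nonTrivial⇒n>1; >-nonZero)
open import Data.Nat.Properties
open import Data.Nat.Divisibility
  using (_∣_; _∣?_; divides; ∣-trans; ∣m⇒∣m*n; ∣n⇒∣m*n; m∣m*n; n∣m*n; ∣⇒≤; ∣1⇒≡1;
         *-monoˡ-∣; *-cancelˡ-∣)
open import Data.Nat.Primality
  using (Prime; euclidsLemma; prime⇒irreducible; prime⇒nonTrivial; prime⇒nonZero;
         productOfPrimes≥1)
open import Data.Nat.Primality.Factorisation using (factorise; factorisationHasAllPrimeFactors)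
open import Data.Nat.Coprimality using (Coprime; coprime-divisor) renaming (sym to coprime-sym)
open import Data.Nat.ListAction using (product)
open import Data.Nat.ListAction.Properties using (∈⇒∣product)
open import Data.List using (List; []; _∷_; take; length)
open import Data.List.Membership.Propositional using (_∈_)
open import Data.List.Membership.Propositional.Properties using (∈-filter⁺; ∈-filter⁻)
open import Data.List.Relation.Unary.Any using (here; there)
open import Data.List.Relation.Unary.All using (All; []; _∷_; lookup)
open import Data.List.Relation.Unary.All.Properties using (take⁺; filter⁺)
open import Data.List.Relation.Unary.Linked using (Linked; []; [-]; _∷_; tail)
open import Data.Product using (∃-syntax; _×_; _,_; proj₁; proj₂)
open import Data.Sum using (_⊎_; inj₁; inj₂; [_,_]′) renaming (map to ⊎-map)
open import Data.Empty using (⊥; ⊥-elim)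
open import Function using (_∘_)
open import Relation.Nullary using (¬_; yes; no)
open import Relation.Binary.Definitions using (tri<; tri≈; tri>)
open import Relation.Binary.PropositionalEquality
  using (_≡_; _≢_; _≗_; refl; sym; trans; cong; cong₂; subst; subst₂; module ≡-Reasoning)
open import Relation.Binary.Construct.Closure.ReflexiveTransitive using (Star; gmap)
open import Data.Nat.Tactic.RingSolver using (solve-∀)

prime>1 : ∀ {p} → Prime p → 1 < p
prime>1 {p} pp = nonTrivial⇒n>1 p {{prime⇒nonTrivial pp}}

prime-coprime : ∀ {q m n} → Prime q → Coprime m n → q ∣ m → q ∣ n → ⊥
prime-coprime pq c q∣m q∣n = <-irrefl (sym (c (q∣m , q∣n))) (prime>1 pq)

prime-factor : ∀ {x} → 1 < x → ∃[ q ] (Prime q × q ∣ x)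
prime-factor {suc zero} (s≤s ())
prime-factor {suc (suc k)} _ with factorise (suc (suc k))
... | record { factors = [] ; isFactorisation = () }
... | record { factors = q ∷ qs ; isFactorisation = eq ; factorsPrime = pq ∷ _ } =
  q , pq , subst (q ∣_) (sym eq) (m∣m*n (product qs))

prime-transfer : ∀ {q X Y Z W} → Prime q → X * Y ≡ Z * W → q ∣ W → ¬ (q ∣ Y) → q ∣ X
prime-transfer {q} {X} {Y} {Z} pq eq q∣W q∤Y =
  [ (λ q∣X → q∣X) , (λ q∣Y → ⊥-elim (q∤Y q∣Y)) ]′
    (euclidsLemma X Y pq (subst (q ∣_) (sym eq) (∣n⇒∣m*n Z q∣W)))

PrimeOrOne : ℕ → Set
PrimeOrOne n = Prime n ⊎ n ≡ 1

composite : ∀ {x p} → 1 < x → 1 < p → ¬ PrimeOrOne (x * p)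
composite {x} {p} 1<x 1<p (inj₂ xp≡1) =
  <-irrefl (sym xp≡1) (<-≤-trans 1<x (m≤m*n x p {{>-nonZero (<-trans z<s 1<p)}}))
composite {x} {p} 1<x 1<p (inj₁ prime-xp) with prime⇒irreducible prime-xp (m∣m*n {x} p)
... | inj₁ x≡1  = <-irrefl (sym x≡1) 1<x
... | inj₂ x≡xp = <-irrefl (*-cancelˡ-≡ 1 p x {{>-nonZero (<-trans z<s 1<x)}} (trans (*-identityʳ x) x≡xp)) 1<p

prime-coprime-to : ∀ {p y} → Prime p → ¬ (p ∣ y) → Coprime p y
prime-coprime-to pp p∤y (d∣p , d∣y) with prime⇒irreducible pp d∣p
... | inj₁ d≡1 = d≡1
... | inj₂ refl = ⊥-elim (p∤y d∣y)

square-in-factor : ∀ {p x y} → Prime p → ¬ (p ∣ y) → p ∣ x → p * p ∣ x * y → p * p ∣ x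
square-in-factor {p} {y = y} pp p∤y (divides q refl) pp∣qpy = *-monoˡ-∣ p p∣q
  where
  instance
    p-nonZero : NonZero p
    p-nonZero = prime⇒nonZero pp
  reorder : ∀ q p y → q * p * y ≡ p * (y * q)
  reorder = solve-∀
  p∣q : p ∣ q
  p∣q = coprime-divisor (prime-coprime-to pp p∤y)
          (*-cancelˡ-∣ p (subst (p * p ∣_) (reorder q p y) pp∣qpy))

square-free-product : ∀ {a b} → SquareFreeRational a b → SquareFree (a * b)
square-free-product {a} {b} (_ , _ , cop , sf-a , sf-b) p pp pp∣ab
  with euclidsLemma a b pp (∣-trans (m∣m*n p) pp∣ab)
... | inj₁ p∣a = sf-a p pp (square-in-factor pp (prime-coprime pp cop p∣a) p∣a pp∣ab)
... | inj₂ p∣b = sf-b p pp (square-in-factor pp (λ p∣a → prime-coprime pp cop p∣a p∣b) p∣b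
                              (subst (p * p ∣_) (*-comm a b) pp∣ab))

strictly-decreasing : ∀ {xs} → Linked _≥_ xs → All Prime xs → SquareFree (product xs) → Linked _>_ xs
strictly-decreasing {[]}    _ _ _ = []
strictly-decreasing {x ∷ []} _ _ _ = [-]
strictly-decreasing {x ∷ y ∷ zs} (x≥y ∷ l) (px ∷ prims) sf with x ≟ y
... | yes refl = ⊥-elim (sf x px (subst (x * x ∣_) (*-assoc x x (product zs)) (m∣m*n (product zs))))
... | no x≢y  = ≤∧≢⇒< x≥y (x≢y ∘ sym) ∷ strictly-decreasing l prims (λ p pp d → sf p pp (∣n⇒∣m*n x d))

pAt∈ : ∀ {xs n} → n < length xs → pAt xs n ∈ xs
pAt∈ {x ∷ xs} {zero}  _         = here refl
pAt∈ {x ∷ xs} {suc n} (s≤s n<) = there (pAt∈ n<)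

pAt∈take : ∀ {xs n m} → n < m → m ≤ length xs → pAt xs n ∈ take m xs
pAt∈take {x ∷ xs} {zero}  {suc m} _         _        = here refl
pAt∈take {x ∷ xs} {suc n} {suc m} (s≤s n<m) (s≤s m≤) = there (pAt∈take n<m m≤)

pAt-below-head : ∀ {y xs n} → Linked _>_ (y ∷ xs) → n < length xs → pAt xs n < y
pAt-below-head {xs = x ∷ xs} {zero}  (y>x ∷ _) _         = y>x
pAt-below-head {xs = x ∷ xs} {suc n} (y>x ∷ l) (s≤s n<) = <-trans (pAt-below-head l n<) y>x

pAt-below-take : ∀ {xs n z} → Linked _>_ xs → n < length xs → z ∈ take n xs → pAt xs n < z
pAt-below-take {y ∷ xs} {suc n} l (s≤s n<) (here refl) = pAt-below-head l n<
pAt-below-take {y ∷ xs} {suc n} l (s≤s n<) (there z∈) = pAt-below-take (tail l) n< z∈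

prodF : (ℕ → ℕ) → ℕ → ℕ
prodF f zero    = 1
prodF f (suc M) = prodF f M * f M

prodNum≡prodF : ∀ M s → prodNum M s ≡ prodF (proj₁ ∘ s) M
prodNum≡prodF zero    s = refl
prodNum≡prodF (suc M) s = cong (_* proj₁ (s M)) (prodNum≡prodF M s)

prodDen≡prodF : ∀ M s → prodDen M s ≡ prodF (proj₂ ∘ s) M
prodDen≡prodF zero    s = refl
prodDen≡prodF (suc M) s = cong (_* proj₂ (s M)) (prodDen≡prodF M s)

factor∣prodF : ∀ f {i M} → i < M → f i ∣ prodF f M
factor∣prodF f {i} {suc M} i<1+M with m≤n⇒m<n∨m≡n (≤-pred i<1+M)
... | inj₁ i<M  = ∣m⇒∣m*n (f M) (factor∣prodF f i<M)
... | inj₂ refl = n∣m*n (prodF f M)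

prime∣prodF : ∀ f M {q} → Prime q → q ∣ prodF f M → ∃[ i ] (q ∣ f i)
prime∣prodF f zero    pq q∣1 = ⊥-elim (<-irrefl (sym (∣1⇒≡1 q∣1)) (prime>1 pq))
prime∣prodF f (suc M) pq q∣ with euclidsLemma (prodF f M) (f M) pq q∣
... | inj₁ q∣prod = prime∣prodF f M pq q∣prod
... | inj₂ q∣fM   = M , q∣fM

prodF-pos : ∀ {f} M → (∀ i → 0 < f i) → 0 < prodF f M
prodF-pos zero    _   = z<s
prodF-pos {f} (suc M) pos = *-pos (prodF-pos M pos) (pos M)
  where
  *-pos : ∀ {m n} → 0 < m → 0 < n → 0 < m * n
  *-pos {suc m} {suc n} _ _ = z<s

prodF-stable : ∀ {f M} L → (∀ i → M ≤ i → f i ≡ 1) → M ≤ L → prodF f L ≡ prodF f M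
prodF-stable zero    _   z≤n = refl
prodF-stable {f} {M} (suc L) one M≤1+L with m≤n⇒m<n∨m≡n M≤1+L
... | inj₂ refl = refl
... | inj₁ (s≤s M≤L) = begin
  prodF f L * f L ≡⟨ cong (prodF f L *_) (one L M≤L) ⟩
  prodF f L * 1   ≡⟨ *-identityʳ _ ⟩
  prodF f L       ≡⟨ prodF-stable L one M≤L ⟩
  prodF f M       ∎
  where open ≡-Reasoning

value : ℕ → Seq → ℕ × ℕ
value M s = prodNum M s , prodDen M s

_≋_ : ℕ × ℕ → ℕ × ℕ → Set
x ≋ y = proj₁ x * proj₂ y ≡ proj₁ y * proj₂ x

≋-sym : ∀ {x y} → x ≋ y → y ≋ x
≋-sym = sym

≋-trans : ∀ {x y z} → 0 < proj₂ y → x ≋ y → y ≋ z → x ≋ z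
≋-trans {x₁ , x₂} {y₁ , y₂} {z₁ , z₂} y₂>0 xy yz =
  *-cancelˡ-≡ (x₁ * z₂) (z₁ * x₂) y₂ {{>-nonZero y₂>0}} (begin
    y₂ * (x₁ * z₂) ≡⟨ shuffle y₂ x₁ z₂ ⟩
    x₁ * y₂ * z₂   ≡⟨ cong (_* z₂) xy ⟩
    y₁ * x₂ * z₂   ≡⟨ shuffle′ y₁ x₂ z₂ ⟩
    y₁ * z₂ * x₂   ≡⟨ cong (_* x₂) yz ⟩
    z₁ * y₂ * x₂   ≡⟨ shuffle″ z₁ y₂ x₂ ⟩
    y₂ * (z₁ * x₂) ∎)
  where
  open ≡-Reasoning
  shuffle : ∀ a b c → a * (b * c) ≡ b * a * c
  shuffle = solve-∀
  shuffle′ : ∀ a b c → a * b * c ≡ a * c * b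
  shuffle′ = solve-∀
  shuffle″ : ∀ a b c → a * b * c ≡ b * (a * c)
  shuffle″ = solve-∀

value-stable : ∀ {M s} L → Supported M s → M ≤ L → value L s ≡ value M s
value-stable {M} {s} L sup M≤L = cong₂ _,_
  (begin
    prodNum L s          ≡⟨ prodNum≡prodF L s ⟩
    prodF (proj₁ ∘ s) L  ≡⟨ prodF-stable L (λ i M≤i → cong proj₁ (sup i M≤i)) M≤L ⟩
    prodF (proj₁ ∘ s) M  ≡⟨ sym (prodNum≡prodF M s) ⟩
    prodNum M s          ∎)
  (begin
    prodDen L s          ≡⟨ prodDen≡prodF L s ⟩
    prodF (proj₂ ∘ s) L  ≡⟨ prodF-stable L (λ i M≤i → cong proj₂ (sup i M≤i)) M≤L ⟩
    prodF (proj₂ ∘ s) M  ≡⟨ sym (prodDen≡prodF M s) ⟩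
    prodDen M s          ∎)
  where open ≡-Reasoning

prodDen-pos : ∀ {s} M → (∀ i → 0 < proj₂ (s i)) → 0 < prodDen M s
prodDen-pos {s} M pos = subst (0 <_) (sym (prodDen≡prodF M s)) (prodF-pos M pos)

supported-mono : ∀ {M s} L → Supported M s → M ≤ L → Supported L s
supported-mono L sup M≤L i L≤i = sup i (≤-trans M≤L L≤i)

≋value-lift : ∀ {x M s} L → Supported M s → M ≤ L → x ≋ value M s → x ≋ value L s
≋value-lift {x} L sup M≤L e = subst (x ≋_) (sym (value-stable L sup M≤L)) e

values-lift : ∀ {M s t} L → Supported M s → Supported M t → M ≤ L →
              value M s ≋ value M t → value L s ≋ value L t
values-lift L ss st M≤L = subst₂ _≋_ (sym (value-stable L ss M≤L)) (sym (value-stable L st M≤L))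

sameValue-trans : ∀ {s t u} → (∀ i → 0 < proj₂ (t i)) → SameValue s t → SameValue t u → SameValue s u
sameValue-trans {s} {t} {u} pos (M₁ , s₁ , t₁ , st) (M₂ , t₂ , u₂ , tu) =
  L , supported-mono L s₁ M₁≤L , supported-mono L u₂ M₂≤L ,
  ≋-trans {value L s} {value L t} {value L u} (prodDen-pos L pos)
    (values-lift L s₁ t₁ M₁≤L st) (values-lift L t₂ u₂ M₂≤L tu)
  where
  L : ℕ
  L = M₁ ⊔ M₂
  M₁≤L : M₁ ≤ L
  M₁≤L = m≤m⊔n M₁ M₂
  M₂≤L : M₂ ≤ L
  M₂≤L = m≤n⊔m M₁ M₂

measEq-sym : ∀ {s t} → MeasEq s t → MeasEq t s
measEq-sym ((M , ss , st , e) , mx≡) = (M , st , ss , sym e) , λ i → sym (mx≡ i)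

measEq-trans : ∀ {s t u} → (∀ i → 0 < proj₂ (t i)) → MeasEq s t → MeasEq t u → MeasEq s u
measEq-trans pos (st , mx-st) (tu , mx-tu) =
  sameValue-trans pos st tu , λ i → trans (mx-st i) (mx-tu i)

inside-support : ∀ {M s i q} → Supported M s → Prime q → q ∣ proj₁ (s i) ⊎ q ∣ proj₂ (s i) → i < M
inside-support {M} {s} {i} {q} sup pq q∣ with i <? M
... | yes i<M = i<M
... | no i≮M = ⊥-elim (<-irrefl (sym (∣1⇒≡1 (entry∣1 q∣))) (prime>1 pq))
  where
  entry∣1 : q ∣ proj₁ (s i) ⊎ q ∣ proj₂ (s i) → q ∣ 1
  entry∣1 (inj₁ q∣a) = subst (q ∣_) (cong proj₁ (sup i (≮⇒≥ i≮M))) q∣a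
  entry∣1 (inj₂ q∣b) = subst (q ∣_) (cong proj₂ (sup i (≮⇒≥ i≮M))) q∣b

numerator-factor : ∀ {A B s i q} → IsFactorizationOf A B s → Prime q → q ∣ proj₁ (s i) → q ∣ A
numerator-factor {A} {B} {s} {i} {q} (_ , (M , sup , eq) , _ , cop) pq q∣ =
  prime-transfer {X = A} {Z = B} pq eq
    (subst (q ∣_) (sym (prodNum≡prodF M s))
       (∣-trans q∣ (factor∣prodF (proj₁ ∘ s) (inside-support sup pq (inj₁ q∣)))))
    (λ q∣D → let (j , q∣bj) = prime∣prodF (proj₂ ∘ s) M pq (subst (q ∣_) (prodDen≡prodF M s) q∣D)
             in prime-coprime pq (cop i j) q∣ q∣bj)

denominator-factor : ∀ {A B s i q} → IsFactorizationOf A B s → Prime q → q ∣ proj₂ (s i) → q ∣ B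
denominator-factor {A} {B} {s} {i} {q} (_ , (M , sup , eq) , _ , cop) pq q∣ =
  prime-transfer {X = B} {Z = A} pq (sym eq)
    (subst (q ∣_) (sym (prodDen≡prodF M s))
       (∣-trans q∣ (factor∣prodF (proj₂ ∘ s) (inside-support sup pq (inj₂ q∣)))))
    (λ q∣N → let (j , q∣aj) = prime∣prodF (proj₁ ∘ s) M pq (subst (q ∣_) (prodNum≡prodF M s) q∣N)
             in prime-coprime pq (cop j i) q∣aj q∣)

-- x is 1 or exceeds p; every entry of a factorization of α_n is so for p = p_{n+1}
OneOrAbove : ℕ → ℕ → Set
OneOrAbove p x = x ≡ 1 ⊎ p < x

one-or-above : ∀ {p x} → 0 < x → (∀ {q} → Prime q → q ∣ x → p < q) → OneOrAbove p x
one-or-above {p} {x} x>0 above with x ≟ 1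
... | yes x≡1 = inj₁ x≡1
... | no x≢1 with prime-factor (≤∧≢⇒< x>0 (x≢1 ∘ sym))
... | q , pq , q∣x = inj₂ (<-≤-trans (above pq q∣x) (∣⇒≤ {{>-nonZero x>0}} q∣x))

max-avoids : ∀ {p x y} → 1 < p → OneOrAbove p x → OneOrAbove p y → x ⊔ y ≢ p
max-avoids 1<p (inj₁ refl) (inj₁ refl) 1≡p = <-irrefl 1≡p 1<p
max-avoids {x = x} {y} _ (inj₂ p<x) _ e = <-irrefl (sym e) (<-≤-trans p<x (m≤m⊔n x y))
max-avoids {x = x} {y} _ (inj₁ _) (inj₂ p<y) e = <-irrefl (sym e) (<-≤-trans p<y (m≤n⊔m x y))

entry-growth : ∀ {p x y} → 1 < p → OneOrAbove p x → OneOrAbove p y → PrimeOrOne (x * p ⊔ y) →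
               x * p ⊔ y ≡ x ⊔ y ⊎ (x ≡ 1 × y ≡ 1)
entry-growth _ (inj₁ refl) (inj₁ refl) _ = inj₂ (refl , refl)
entry-growth {p} {y = y} 1<p (inj₁ refl) (inj₂ p<y) _ =
  inj₁ (trans (m≤n⇒m⊔n≡n (subst (_≤ y) (sym (*-identityˡ p)) (<⇒≤ p<y)))
              (sym (m≤n⇒m⊔n≡n (<⇒≤ (<-trans 1<p p<y)))))
entry-growth {p} {x} {y} 1<p (inj₂ p<x) _ prime-max with y ≤? x * p
... | yes y≤xp = ⊥-elim (composite (<-trans 1<p p<x) 1<p (subst PrimeOrOne (m≥n⇒m⊔n≡m y≤xp) prime-max))
... | no y≰xp = inj₁ (trans (m≤n⇒m⊔n≡n (<⇒≤ xp<y)) (sym (m≤n⇒m⊔n≡n (<⇒≤ (≤-<-trans x≤xp xp<y)))))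
  where
  xp<y : x * p < y
  xp<y = ≰⇒> y≰xp
  x≤xp : x ≤ x * p
  x≤xp = m≤m*n x p {{>-nonZero (<-trans z<s 1<p)}}

data MaxStep (p : ℕ) (m m′ : ℕ → ℕ) : Set where
  unchanged : m′ ≗ m → MaxStep p m m′
  inserted  : ∀ k → m k ≡ 1 → m′ k ≡ p → (∀ i → i ≢ k → m′ i ≡ m i) → MaxStep p m m′

max-step : ∀ {p} {m m′ : ℕ → ℕ} {k x y} → 1 < p → OneOrAbove p x → OneOrAbove p y →
           m k ≡ x ⊔ y → m′ k ≡ x * p ⊔ y → PrimeOrOne (m′ k) → (∀ i → i ≢ k → m′ i ≡ m i) →
           MaxStep p m m′
max-step {p} {m} {m′} {k} 1<p ox oy mk m′k prime-max others
  with entry-growth 1<p ox oy (subst PrimeOrOne m′k prime-max)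
... | inj₁ same = unchanged kept
  where
  kept : m′ ≗ m
  kept i with i ≟ k
  ... | yes refl = trans m′k (trans same (sym mk))
  ... | no i≢k   = others i i≢k
... | inj₂ (refl , refl) =
  inserted k mk (trans m′k (trans (cong (_⊔ 1) (*-identityˡ p)) (m≥n⇒m⊔n≡m (<⇒≤ 1<p)))) others

max-step-cong : ∀ {p} {m₁ m₂ m′ : ℕ → ℕ} → m₁ ≗ m₂ → MaxStep p m₁ m′ → MaxStep p m₂ m′
max-step-cong e (unchanged kept) = unchanged (λ i → trans (kept i) (e i))
max-step-cong e (inserted k mk m′k others) =
  inserted k (trans (sym (e k)) mk) m′k (λ i i≢k → trans (others i i≢k) (e i))

erase : ℕ → ℕ → ℕ
erase p x with x ≟ p
... | yes _ = 1
... | no _  = x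

erase-p : ∀ p → erase p p ≡ 1
erase-p p with p ≟ p
... | yes _  = refl
... | no p≢p = ⊥-elim (p≢p refl)

erase-other : ∀ {p x} → x ≢ p → erase p x ≡ x
erase-other {p} {x} x≢p with x ≟ p
... | yes x≡p = ⊥-elim (x≢p x≡p)
... | no _    = refl

max-step-erase : ∀ {p} {m m′ : ℕ → ℕ} → MaxStep p m m′ → (∀ i → m i ≢ p) → ∀ i → m i ≡ erase p (m′ i)
max-step-erase (unchanged kept) avoids i =
  trans (sym (erase-other (avoids i))) (cong (erase _) (sym (kept i)))
max-step-erase {p} (inserted k mk m′k others) avoids i with i ≟ k
... | yes refl = trans mk (trans (sym (erase-p p)) (cong (erase p) (sym m′k)))
... | no i≢k   = trans (sym (erase-other (avoids i))) (cong (erase p) (sym (others i i≢k)))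

NonIncreasing : (ℕ → ℕ) → Set
NonIncreasing c = ∀ i → c (suc i) ≤ c i

antitone : ∀ {c} → NonIncreasing c → ∀ {i j} → i ≤ j → c j ≤ c i
antitone dec {j = zero} z≤n = ≤-refl
antitone dec {i} {suc j} i≤1+j with m≤n⇒m<n∨m≡n i≤1+j
... | inj₁ (s≤s i≤j) = ≤-trans (dec j) (antitone dec i≤j)
... | inj₂ refl      = ≤-refl

inserted-first : ∀ {p} {m c : ℕ → ℕ} {k j} → 1 < p → NonIncreasing c → c k ≡ p → (∀ i → i ≢ k → c i ≡ m i) →
                 j < k → m j ≢ 1
inserted-first {j = j} 1<p dec ck others j<k mj≡1 =
  <-irrefl refl (<-≤-trans 1<p (subst₂ _≤_ ck (trans (others j (<⇒≢ j<k)) mj≡1) (antitone dec (<⇒≤ j<k))))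

insertions-agree : ∀ {p} {m c₁ c₂ : ℕ → ℕ} {k₁ k₂} → 1 < p → NonIncreasing c₁ → NonIncreasing c₂ →
  m k₁ ≡ 1 → c₁ k₁ ≡ p → (∀ i → i ≢ k₁ → c₁ i ≡ m i) →
  m k₂ ≡ 1 → c₂ k₂ ≡ p → (∀ i → i ≢ k₂ → c₂ i ≡ m i) → c₁ ≗ c₂
insertions-agree {m = m} {c₁} {c₂} {k₁} {k₂} 1<p dec₁ dec₂ m₁ p₁ o₁ m₂ p₂ o₂ with <-cmp k₁ k₂
... | tri< k₁<k₂ _ _ = ⊥-elim (inserted-first {m = m} 1<p dec₂ p₂ o₂ k₁<k₂ m₁)
... | tri> _ _ k₂<k₁ = ⊥-elim (inserted-first {m = m} 1<p dec₁ p₁ o₁ k₂<k₁ m₂)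
... | tri≈ _ refl _ = agree
  where
  agree : c₁ ≗ c₂
  agree i with i ≟ k₁
  ... | yes refl = trans p₁ (sym p₂)
  ... | no i≢k   = trans (o₁ i i≢k) (sym (o₂ i i≢k))

two-of-three : ∀ {p} {m c₁ c₂ c₃ : ℕ → ℕ} → 1 < p → NonIncreasing c₁ → NonIncreasing c₂ → NonIncreasing c₃ →
               MaxStep p m c₁ → MaxStep p m c₂ → MaxStep p m c₃ →
               c₁ ≗ c₂ ⊎ c₁ ≗ c₃ ⊎ c₂ ≗ c₃
two-of-three _ _ _ _ (unchanged e₁) (unchanged e₂) _ = inj₁ (λ i → trans (e₁ i) (sym (e₂ i)))
two-of-three _ _ _ _ (unchanged e₁) (inserted _ _ _ _) (unchanged e₃) = inj₂ (inj₁ (λ i → trans (e₁ i) (sym (e₃ i))))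
two-of-three {m = m} 1<p _ d₂ d₃ (unchanged _) (inserted _ m₂ c₂ o₂) (inserted _ m₃ c₃ o₃) =
  inj₂ (inj₂ (insertions-agree {m = m} 1<p d₂ d₃ m₂ c₂ o₂ m₃ c₃ o₃))
two-of-three _ _ _ _ (inserted _ _ _ _) (unchanged e₂) (unchanged e₃) = inj₂ (inj₂ (λ i → trans (e₂ i) (sym (e₃ i))))
two-of-three {m = m} 1<p d₁ _ d₃ (inserted _ m₁ c₁ o₁) (unchanged _) (inserted _ m₃ c₃ o₃) =
  inj₂ (inj₁ (insertions-agree {m = m} 1<p d₁ d₃ m₁ c₁ o₁ m₃ c₃ o₃))
two-of-three {m = m} 1<p d₁ d₂ _ (inserted _ m₁ c₁ o₁) (inserted _ m₂ c₂ o₂) _ =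
  inj₁ (insertions-agree {m = m} 1<p d₁ d₂ m₁ c₁ o₁ m₂ c₂ o₂)

module Factorizations (a b : ℕ) (ps : List ℕ) (sfr : SquareFreeRational a b) (pl : PrimeList a b ps) where

  primes : All Prime ps
  primes = proj₁ pl

  decreasing : Linked _>_ ps
  decreasing = strictly-decreasing (proj₁ (proj₂ pl)) primes
    (λ p pp d → square-free-product sfr p pp (subst (p * p ∣_) (proj₂ (proj₂ pl)) d))

  coprime-ab : Coprime a b
  coprime-ab = proj₁ (proj₂ (proj₂ sfr))

  p-prime : ∀ {n} → n < length ps → Prime (pAt ps n)
  p-prime n< = lookup primes (pAt∈ n<)

  numα-prime : ∀ {x n q} → Prime q → q ∣ numα x ps n → q ∈ take n ps × q ∣ x
  numα-prime {x} {n} pq q∣ =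
    ∈-filter⁻ (_∣? x) (factorisationHasAllPrimeFactors pq q∣ (filter⁺ (_∣? x) (take⁺ n primes)))

  ∣numα : ∀ {x n q} → q ∈ take n ps → q ∣ x → q ∣ numα x ps n
  ∣numα {x} q∈ q∣x = ∈⇒∣product (∈-filter⁺ (_∣? x) q∈ q∣x)

  numα-pos : ∀ x n → 0 < numα x ps n
  numα-pos x n = productOfPrimes≥1 (filter⁺ (_∣? x) (take⁺ n primes))

  α : ℕ → ℕ × ℕ
  α n = numα a ps n , denα b ps n

  -- for n < m, p_{n+1} divides x and hence numα x ps m, but it divides neither
  -- numα x ps n (only larger primes occur) nor numα y ps m (y is coprime to x)
  level-gap : ∀ {x y n m} → Coprime x y → n < m → m ≤ length ps → pAt ps n ∣ x →
              numα x ps n * numα y ps m ≢ numα x ps m * numα y ps n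
  level-gap {x} {y} {n} {m} cop n<m m≤N p∣x eq =
    [ (λ p∣xn → <-irrefl refl (pAt-below-take decreasing n<N (proj₁ (numα-prime {x} {n} pp p∣xn))))
    , (λ p∣ym → prime-coprime pp cop p∣x (proj₂ (numα-prime {y} {m} pp p∣ym))) ]′
      (euclidsLemma (numα x ps n) (numα y ps m) pp
        (subst (pAt ps n ∣_) (sym eq) (∣m⇒∣m*n (numα y ps n) (∣numα (pAt∈take n<m m≤N) p∣x))))
    where
    n<N : n < length ps
    n<N = <-≤-trans n<m m≤N
    pp : Prime (pAt ps n)
    pp = p-prime n<N

  level-below : ∀ {n m} → n < m → m ≤ length ps → ¬ (α n ≋ α m)
  level-below {n} {m} n<m m≤N eq =
    [ (λ p∣a → level-gap coprime-ab n<m m≤N p∣a eq)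
    , (λ p∣b → level-gap (coprime-sym coprime-ab) n<m m≤N p∣b eq′) ]′
      (euclidsLemma a b (p-prime n<N) p∣ab)
    where
    open ≡-Reasoning
    n<N : n < length ps
    n<N = <-≤-trans n<m m≤N
    p∣ab : pAt ps n ∣ a * b
    p∣ab = subst (pAt ps n ∣_) (proj₂ (proj₂ pl)) (∈⇒∣product (pAt∈ {ps} {n} n<N))
    eq′ : numα b ps n * numα a ps m ≡ numα b ps m * numα a ps n
    eq′ = begin
      numα b ps n * numα a ps m ≡⟨ *-comm (numα b ps n) _ ⟩
      numα a ps m * numα b ps n ≡⟨ sym eq ⟩
      numα a ps n * numα b ps m ≡⟨ *-comm (numα a ps n) _ ⟩
      numα b ps m * numα a ps n ∎

  levels-distinct : ∀ {n m} → n ≤ length ps → m ≤ length ps → α n ≋ α m → n ≡ m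
  levels-distinct {n} {m} n≤N m≤N eq with <-cmp n m
  ... | tri< n<m _ _ = ⊥-elim (level-below n<m m≤N eq)
  ... | tri≈ _ n≡m _ = n≡m
  ... | tri> _ _ m<n = ⊥-elim (level-below m<n n≤N (≋-sym {α n} {α m} eq))

  fact-value : ∀ {n s} → FactAt a b ps n s → ∃[ M ] (Supported M s × α n ≋ value M s)
  fact-value {n} {s} (_ , (M , sup , eq) , _) = M , sup , trans eq (*-comm (denα b ps n) (prodNum M s))

  den-positive : ∀ {n s} → FactAt a b ps n s → ∀ i → 0 < proj₂ (s i)
  den-positive f i = proj₂ (proj₁ f i)

  F-den-positive : ∀ {s} → InF a b ps s → ∀ i → 0 < proj₂ (s i)
  F-den-positive (n , _ , f) = den-positive {n} f

  same-level⇒same-value : ∀ {n s t} → FactAt a b ps n s → FactAt a b ps n t → SameValue s t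
  same-level⇒same-value {n} {s} {t} fs ft with fact-value {n} fs | fact-value {n} ft
  ... | Ms , ss , es | Mt , st , et =
    L , supported-mono L ss Ms≤L , supported-mono L st Mt≤L ,
    ≋-trans {value L s} {α n} {value L t} (numα-pos b n)
      (≋-sym {α n} {value L s} (≋value-lift {α n} L ss Ms≤L es)) (≋value-lift {α n} L st Mt≤L et)
    where
    L : ℕ
    L = Ms ⊔ Mt
    Ms≤L : Ms ≤ L
    Ms≤L = m≤m⊔n Ms Mt
    Mt≤L : Mt ≤ L
    Mt≤L = m≤n⊔m Ms Mt

  same-value⇒same-level : ∀ {n m s t} → n ≤ length ps → m ≤ length ps →
                          FactAt a b ps n s → FactAt a b ps m t → SameValue s t → n ≡ m
  same-value⇒same-level {n} {m} {s} {t} n≤N m≤N fs ft (M , ss , st , e)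
    with fact-value {n} fs | fact-value {m} ft
  ... | Ms , ss′ , es | Mt , st′ , et =
    levels-distinct n≤N m≤N
      (≋-trans {α n} {value L s} {α m} (prodDen-pos L (den-positive {n} fs)) (≋value-lift {α n} L ss′ Ms≤L es)
        (≋-trans {value L s} {value L t} {α m} (prodDen-pos L (den-positive {m} ft)) (values-lift L ss st M≤L e)
          (≋-sym {α m} {value L t} (≋value-lift {α m} L st′ Mt≤L et))))
    where
    L : ℕ
    L = M ⊔ (Ms ⊔ Mt)
    M≤L : M ≤ L
    M≤L = m≤m⊔n M (Ms ⊔ Mt)
    Ms≤L : Ms ≤ L
    Ms≤L = ≤-trans (m≤m⊔n Ms Mt) (m≤n⊔m M (Ms ⊔ Mt))
    Mt≤L : Mt ≤ L
    Mt≤L = ≤-trans (m≤n⊔m Ms Mt) (m≤n⊔m M (Ms ⊔ Mt))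

  entry-prime : ∀ {n s i q} → FactAt a b ps n s → Prime q →
                q ∣ proj₁ (s i) ⊎ q ∣ proj₂ (s i) → q ∈ take n ps
  entry-prime {n} f pq (inj₁ q∣) = proj₁ (numα-prime {a} {n} pq (numerator-factor {numα a ps n} {denα b ps n} f pq q∣))
  entry-prime {n} f pq (inj₂ q∣) = proj₁ (numα-prime {b} {n} pq (denominator-factor {numα a ps n} {denα b ps n} f pq q∣))

  numerator-above : ∀ {n s} → FactAt a b ps n s → n < length ps → ∀ i → OneOrAbove (pAt ps n) (proj₁ (s i))
  numerator-above f n<N i =
    one-or-above (proj₁ (proj₁ f i)) (λ pq q∣ → pAt-below-take decreasing n<N (entry-prime f pq (inj₁ q∣)))

  denominator-above : ∀ {n s} → FactAt a b ps n s → n < length ps → ∀ i → OneOrAbove (pAt ps n) (proj₂ (s i))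
  denominator-above f n<N i =
    one-or-above (proj₂ (proj₁ f i)) (λ pq q∣ → pAt-below-take decreasing n<N (entry-prime f pq (inj₂ q∣)))

  record Edge (n : ℕ) (u v : Seq) : Set where
    field
      n<N    : n < length ps
      parent : FactAt a b ps n u
      child  : FactAt a b ps (suc n) v
      step   : MaxStep (pAt ps n) (mx u) (mx v)
      avoids : ∀ i → mx u i ≢ pAt ps n
      grown  : ∃[ k ] (1 < mx v k)

  growth-edge : ∀ {n u v} → n < length ps → FactAt a b ps n u → FactAt a b ps (suc n) v → IsPrimitive v →
                ∀ k {x y} → 0 < x → OneOrAbove (pAt ps n) x → OneOrAbove (pAt ps n) y →
                mx u k ≡ x ⊔ y → mx v k ≡ x * pAt ps n ⊔ y → (∀ i → i ≢ k → mx v i ≡ mx u i) → Edge n u v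
  growth-edge {n} n<N fu fv prim k {x} {y} x>0 ox oy uk vk others = record
    { n<N    = n<N
    ; parent = fu
    ; child  = fv
    ; step   = max-step 1<p ox oy uk vk (prim k) others
    ; avoids = λ i → max-avoids 1<p (numerator-above fu n<N i) (denominator-above fu n<N i)
    ; grown  = k , subst (1 <_) (sym vk)
                 (<-≤-trans 1<p (≤-trans (m≤n*m p x {{>-nonZero x>0}}) (m≤m⊔n (x * p) y)))
    }
    where
    p : ℕ
    p = pAt ps n
    1<p : 1 < p
    1<p = prime>1 (p-prime n<N)

  edge : ∀ {u v} → IsPrimitive v → DirectSub a b ps u v → ∃[ n ] Edge n u v
  edge prim (n , n<N , fu , fv , inj₁ (_ , k , den≡ , num≡ , num-k)) =
    n , growth-edge n<N fu fv prim k (proj₁ (proj₁ fu k))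
          (numerator-above fu n<N k) (denominator-above fu n<N k)
          refl (cong₂ _⊔_ num-k (den≡ k)) (λ i i≢k → cong₂ _⊔_ (num≡ i i≢k) (den≡ i))
  edge {u} prim (n , n<N , fu , fv , inj₂ (_ , k , num≡ , den≡ , den-k)) =
    n , growth-edge n<N fu fv prim k (proj₂ (proj₁ fu k))
          (denominator-above fu n<N k) (numerator-above fu n<N k)
          (⊔-comm (proj₁ (u k)) _) (trans (cong₂ _⊔_ (num≡ k) den-k) (⊔-comm (proj₁ (u k)) _))
          (λ i i≢k → cong₂ _⊔_ (num≡ i) (den≡ i i≢k))

  child-nonIncreasing : ∀ {n u v} → Edge n u v → NonIncreasing (mx v)
  child-nonIncreasing e = proj₁ (proj₂ (proj₂ (Edge.child e)))

  same-child : ∀ {n n′ u u′ v v′} → Edge n u v → Edge n′ u′ v′ → n ≡ n′ → mx v ≗ mx v′ → MeasEq v v′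
  same-child {n} e e′ refl mx≡ = same-level⇒same-value {suc n} (Edge.child e) (Edge.child e′) , mx≡

  step-at : ∀ {n n′ u v} → n′ ≡ n → Edge n′ u v → MaxStep (pAt ps n) (mx u) (mx v)
  step-at refl e = Edge.step e

  edge-levels : ∀ {n n′ u u′ v v′} → Edge n u v → Edge n′ u′ v′ → MeasEq u u′ → n ≡ n′
  edge-levels {n} {n′} e e′ (uu′ , _) =
    same-value⇒same-level {n} {n′} (<⇒≤ (Edge.n<N e)) (<⇒≤ (Edge.n<N e′)) (Edge.parent e) (Edge.parent e′) uu′

  parents-equivalent : ∀ {n n′ u u′ v v′} → Edge n u v → Edge n′ u′ v′ → MeasEq v v′ → MeasEq u u′
  parents-equivalent {n} {n′} {u} {u′} {v} {v′} e e′ (vv′ , mx≡) = parent-values levels , λ i →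
    trans (max-step-erase (Edge.step e) (Edge.avoids e) i)
      (trans (cong (erase (pAt ps n)) (mx≡ i))
        (trans (cong (λ l → erase (pAt ps l) (mx v′ i)) levels)
          (sym (max-step-erase (Edge.step e′) (Edge.avoids e′) i))))
    where
    levels : n ≡ n′
    levels = suc-injective (same-value⇒same-level {suc n} {suc n′}
               (Edge.n<N e) (Edge.n<N e′) (Edge.child e) (Edge.child e′) vv′)
    parent-values : n ≡ n′ → SameValue u u′
    parent-values refl = same-level⇒same-value {n} (Edge.parent e) (Edge.parent e′)

  siblings : ∀ {n₁ n₂ n₃ u₁ u₂ u₃ v₁ v₂ v₃} → Edge n₁ u₁ v₁ → Edge n₂ u₂ v₂ → Edge n₃ u₃ v₃ →
             MeasEq u₁ u₂ → MeasEq u₁ u₃ → MeasEq v₁ v₂ ⊎ MeasEq v₁ v₃ ⊎ MeasEq v₂ v₃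
  siblings {n₁} {n₂} {n₃} e₁ e₂ e₃ u₁₂ u₁₃ =
    ⊎-map (same-child e₁ e₂ n₁≡n₂) (⊎-map (same-child e₁ e₃ n₁≡n₃) (same-child e₂ e₃ (trans (sym n₁≡n₂) n₁≡n₃)))
      (two-of-three (prime>1 (p-prime (Edge.n<N e₁)))
        (child-nonIncreasing e₁) (child-nonIncreasing e₂) (child-nonIncreasing e₃)
        (Edge.step e₁)
        (max-step-cong (λ i → sym (proj₂ u₁₂ i)) (step-at (sym n₁≡n₂) e₂))
        (max-step-cong (λ i → sym (proj₂ u₁₃ i)) (step-at (sym n₁≡n₃) e₃)))
    where
    n₁≡n₂ : n₁ ≡ n₂
    n₁≡n₂ = edge-levels e₁ e₂ u₁₂
    n₁≡n₃ : n₁ ≡ n₃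
    n₁≡n₃ = edge-levels e₁ e₃ u₁₃

  module MeasureClassGraph
    {T : Digraph} {r₀ : V T} {ν : V T → Seq}
    (T-rooted    : IsRootedTree T r₀)
    (ν∈F         : ∀ r → InF a b ps (ν r))
    (ν-root      : ν r₀ ≐ trivial)
    (ν-edge      : ∀ r s → E T r s → DirectSub a b ps (ν r) (ν s))
    (ν-primitive : ∀ r → IsPrimitive (ν r))
    {G : Digraph} {μ : V G → Seq}
    (μ∈F         : ∀ g → InF a b ps (μ g))
    (μ-injective : ∀ g h → MeasEq (μ g) (μ h) → g ≡ h)
    (π           : V T → V G)
    (π-onto      : ∀ g → ∃[ r ] π r ≡ g)
    (π-edge      : ∀ r s → E T r s → E G (π r) (π s))
    (π-class     : ∀ r → MeasEq (μ (π r)) (ν r))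
    (edge-lift   : ∀ g h → E G g h → ∃[ r ] ∃[ s ] (E T r s × π r ≡ g × π s ≡ h))
    where

    tree-edge : ∀ {r s} → E T r s → ∃[ n ] Edge n (ν r) (ν s)
    tree-edge {r} {s} rs = edge (ν-primitive s) (ν-edge r s rs)

    same-image : ∀ {r s} → MeasEq (ν r) (ν s) → π r ≡ π s
    same-image {r} {s} rs = μ-injective (π r) (π s)
      (measEq-trans (F-den-positive (ν∈F r)) (π-class r)
        (measEq-trans (F-den-positive (ν∈F s)) rs (measEq-sym (π-class s))))

    image-class : ∀ {r s} → π r ≡ π s → MeasEq (ν r) (ν s)
    image-class {r} {s} πr≡πs =
      measEq-trans (F-den-positive (μ∈F (π s)))
        (subst (λ g → MeasEq (ν r) (μ g)) πr≡πs (measEq-sym (π-class r))) (π-class s)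

    -- every child in T has an entry > 1, the root has none
    root-has-no-parent : ∀ g → ¬ E G g (π r₀)
    root-has-no-parent g e with edge-lift g (π r₀) e
    ... | r , s , rs , _ , πs≡πr₀ with Edge.grown (proj₂ (tree-edge rs))
    ... | k , 1<mx = <-irrefl (sym mx≡1) 1<mx
      where
      mx≡1 : mx (ν s) k ≡ 1
      mx≡1 = trans (proj₂ (image-class πs≡πr₀) k) (cong (λ x → proj₁ x ⊔ proj₂ x) (ν-root k))

    -- a vertex of G has at most one parent, since parent classes are determined by children
    parents-agree : ∀ {g g′ h} → E G g h → E G g′ h → g ≡ g′
    parents-agree {g} {g′} {h} e e′ with edge-lift g h e | edge-lift g′ h e′
    ... | r , s , rs , refl , πs≡h | r′ , s′ , rs′ , refl , πs′≡h =
      same-image (parents-equivalent (proj₂ (tree-edge rs)) (proj₂ (tree-edge rs′))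
        (image-class (trans πs≡h (sym πs′≡h))))

    unique-parent : ∀ h → h ≢ π r₀ → ∃[ g ] (E G g h × (∀ g′ → E G g′ h → g′ ≡ g))
    unique-parent h h≢root with π-onto h
    ... | s , refl with proj₁ (proj₂ T-rooted) s (λ s≡r₀ → h≢root (cong π s≡r₀))
    ... | r , rs , _ = π r , π-edge r s rs , λ g′ e′ → parents-agree e′ (π-edge r s rs)

    reachable : ∀ h → Star (E G) (π r₀) h
    reachable h with π-onto h
    ... | s , refl = gmap π (λ {r} {s} → π-edge r s) (proj₂ (proj₂ T-rooted) s)

    -- three children of g come from three edges of T with equivalent parents; two coincide
    at-most-two-children : ∀ g h₁ h₂ h₃ → E G g h₁ → E G g h₂ → E G g h₃ → h₁ ≡ h₂ ⊎ h₁ ≡ h₃ ⊎ h₂ ≡ h₃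
    at-most-two-children g h₁ h₂ h₃ e₁ e₂ e₃
      with edge-lift g h₁ e₁ | edge-lift g h₂ e₂ | edge-lift g h₃ e₃
    ... | r₁ , s₁ , t₁ , πr₁ , refl | r₂ , s₂ , t₂ , πr₂ , refl | r₃ , s₃ , t₃ , πr₃ , refl =
      ⊎-map same-image (⊎-map same-image same-image)
        (siblings (proj₂ (tree-edge t₁)) (proj₂ (tree-edge t₂)) (proj₂ (tree-edge t₃))
          (image-class (trans πr₁ (sym πr₂))) (image-class (trans πr₁ (sym πr₃))))

    is-binary-tree : IsBinaryTree G
    is-binary-tree = π r₀ , (root-has-no-parent , unique-parent , reachable) , at-most-two-children

-- Theorem 2.12.

theorem2p12 : (a b : ℕ) (ps : List ℕ) →
    SquareFreeRational a b → PrimeList a b ps →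
    (T : Digraph) (r₀ : V T) (ν : V T → Seq) →
    IsPrimitiveFactorizationTree a b ps T r₀ ν →
    (G : Digraph) (μ : V G → Seq) →
    IsMeasureClassGraph a b ps T ν G μ →
    IsBinaryTree G
theorem2p12 a b ps sfr pl T r₀ ν ((T-rooted , ν∈F , ν-root , _ , _ , ν-edge) , ν-primitive) G μ
            (μ∈F , μ-injective , π , π-onto , π-edge , π-class , edge-lift) =
  MeasureClassGraph.is-binary-tree T-rooted ν∈F ν-root ν-edge ν-primitive
    μ∈F μ-injective π π-onto π-edge π-class edge-lift
  where open Factorizations a b ps sfr pl
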